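{- Let $L$ be a complete lattice, let $X$ be a nonempty set and let $\mu: X\to L$ be an $L$-fuzzy set. Then: (a) $(\mu_L,\supseteq)\cong (L^{\mu},\leq)$, i.e. the family of cuts of $\mu$ ordered by reverse inclusion is order-isomorphic to $L^{\mu}$ with the order inherited from $L$; (b) $L^{\mu}$ can be embedded into $L$ by $\iota_{(L^{\mu},L)}$-embedding; (c) $\mu=\iota_{(L^{\mu},L)}\circ\nu$, where $\nu: X\to L^{\mu}$ is defined by $\nu(x)=\mu(x)$ for all $x\in X$; moreover $\nu_{L^{\mu}}=\mu_L$ and $(L^{\mu})^{\nu}=L^{\mu}$.
   Context: An $L$-fuzzy set on a nonempty set $X$ is a mapping $\mu:X\to L$ into a complete lattice $(L,\wedge,\vee,0_L,1_L)$. For $p\in L$, the $p$-cut of $\mu$ is $\mu_p=\{x\in X\mid \mu(x)\geq p\}$, and $\mu_L=\{\mu_p\mid p\in L\}$ is the family of all cuts. Put $L^{\mu}=\{p\in L\mid p=\bigwedge B \text{ for some } B\subseteq \mu(X)\}$, where $\mu(X)=\{\mu(x)\mid x\in X\}$ and $\bigwedge\emptyset=1_L$; $L^{\mu}$ with the order of $L$ is a complete lattice. For a sub-poset $(M,\leq)$ of a poset $(N,\leq)$, $\iota_{(M,N)}:M\to N$ denotes the inclusion map $\iota_{(M,N)}(x)=x$. If $(L_1,\leq)$ is a sub-poset of a complete lattice $(L,\leq)$, the map $\iota_{(L_1,L)}$ is called an $\iota_{(L_1,L)}$-embedding (and "$L_1$ can be embedded into $L$ by $\iota_{(L_1,L)}$-embedding")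 if it preserves all infima and the top element: for every $S\subseteq L_1$ the infimum of $S$ in $L_1$ exists and equals the infimum of $S$ in $L$, and the top element of $L_1$ is $1_L$. For a complete lattice $K$ and $\nu:X\to K$, $\nu_K$ and $K^{\nu}$ are defined analogously with $K$ in place of $L$. -}

module Defs where

open import Level using (Level; _⊔_; suc; Setω)
open import Data.Product using (Σ; ∃; _×_; _,_; proj₁; proj₂)
open import Relation.Unary using (Pred; _⊆_; _⊇_; _≐_; ∅)
open import Relation.Binary.Bundles using (Poset)
import Relation.Binary.Construct.On as On

module _ {c ℓ₁ ℓ₂ : Level} (P : Poset c ℓ₁ ℓ₂) where
  open Poset P

  IsLowerBound : ∀ {s} → Pred Carrier s → Carrier → Set _
  IsLowerBound B p = ∀ {b} → B b → p ≤ b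

  IsInfimum : ∀ {s} → Pred Carrier s → Carrier → Set _
  IsInfimum B p = IsLowerBound B p × (∀ {q} → IsLowerBound B q → q ≤ p)

  IsTop : Carrier → Set _
  IsTop t = ∀ q → q ≤ t

-- Complete lattices: posets in which every subset (of every level) has
-- an infimum.  (Arbitrary suprema, joins, meets, 0 and 1 are derived.)

record CompleteLattice (c ℓ₁ ℓ₂ : Level) : Setω where
  field
    poset : Poset c ℓ₁ ℓ₂
  open Poset poset public
  field
    inf : ∀ {s} (B : Pred Carrier s) → Σ Carrier (IsInfimum poset B)

module _ {x c ℓ₁ ℓ₂ : Level} {X : Set x} (K : Poset c ℓ₁ ℓ₂)
         (ν : X → Poset.Carrier K) where
  open Poset K

  cut : Carrier → Pred X ℓ₂
  cut p = λ y → p ≤ ν y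

  Cuts : Pred (Pred X ℓ₂) (x ⊔ c ⊔ ℓ₂)
  Cuts S = ∃ λ p → S ≐ cut p

  Image : Pred Carrier (x ⊔ ℓ₁)
  Image k = ∃ λ y → k ≈ ν y

  Kν : Pred Carrier (suc (x ⊔ c ⊔ ℓ₁ ⊔ ℓ₂))
  Kν p = ∃ λ (B : Pred Carrier (x ⊔ c ⊔ ℓ₁ ⊔ ℓ₂)) →
                    (B ⊆ Image) × IsInfimum K B p

module _ {x c ℓ₁ ℓ₂ : Level} {X : Set x} (L : CompleteLattice c ℓ₁ ℓ₂)
         (μ : X → CompleteLattice.Carrier L) where
  open CompleteLattice L

  Lμ : Pred Carrier (suc (x ⊔ c ⊔ ℓ₁ ⊔ ℓ₂))
  Lμ = Kν poset μ

  LμCarrier : Set (suc (x ⊔ c ⊔ ℓ₁ ⊔ ℓ₂))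
  LμCarrier = Σ Carrier Lμ

  ι : LμCarrier → Carrier
  ι = proj₁

  LμPoset : Poset (suc (x ⊔ c ⊔ ℓ₁ ⊔ ℓ₂)) ℓ₁ ℓ₂
  LμPoset = On.poset poset ι

  μLCarrier : Set (suc ℓ₂ ⊔ x ⊔ c)
  μLCarrier = Σ (Pred X ℓ₂) (Cuts poset μ)

  _≐c_ : μLCarrier → μLCarrier → Set (x ⊔ ℓ₂)
  S ≐c T = proj₁ S ≐ proj₁ T

  _⊇c_ : μLCarrier → μLCarrier → Set (x ⊔ ℓ₂)
  S ⊇c T = proj₁ S ⊇ proj₁ T

  ι[_] : ∀ {s} → Pred LμCarrier s → Pred Carrier (suc (x ⊔ c ⊔ ℓ₁ ⊔ ℓ₂) ⊔ s ⊔ ℓ₁)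
  ι[ S ] l = ∃ λ q → S q × l ≈ ι q

module Submission where

-- The map hull p = ⋀ { μ y ∣ p ≤ μ y } is a closure operator on L whose fixed
-- points (the saturated elements) are exactly L^μ.  Since p ≤ μ y ⇔ hull p ≤ μ y,
-- a cut μ_p only depends on hull p, and μ_p ⊇ μ_p' ⇔ hull p ≤ hull p'; so
-- μ_p ↦ hull p is the order isomorphism (a).  Saturated elements are closed under
-- arbitrary infima of L, which gives (b), and every value μ y is saturated, which
-- gives (c).

open import Defs
open import Level using (Level; Lift; lift; _⊔_)
open import Data.Product using (∃; _×_; _,_; proj₁; proj₂)
open import Relation.Unary using (Pred; _≐_; _⊆_; ∅)
open import Relation.Binary.Bundles using (Poset)
open import Relation.Binary.Morphism.Structures using (IsOrderIsomorphism)
open import Relation.Binary.PropositionalEquality using (_≡_)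
import Relation.Binary.PropositionalEquality as ≡

module FuzzySet {x c ℓ₁ ℓ₂ : Level} (L : CompleteLattice c ℓ₁ ℓ₂) {X : Set x}
                (μ : X → CompleteLattice.Carrier L) where
  open CompleteLattice L

  private
    ℓ : Level
    ℓ = x ⊔ c ⊔ ℓ₁ ⊔ ℓ₂

    ≤-respʳ-≈⁻ : ∀ {a b d} → a ≤ b → d ≈ b → a ≤ d
    ≤-respʳ-≈⁻ a≤b d≈b = trans a≤b (reflexive (Eq.sym d≈b))

  Saturated : Carrier → Set _
  Saturated p = ∀ {z} → (∀ y → p ≤ μ y → z ≤ μ y) → z ≤ p

  valuesAbove : Carrier → Pred Carrier ℓ
  valuesAbove p k = Lift ℓ (∃ λ y → p ≤ μ y × k ≈ μ y)

  saturated⇒∈Lμ : ∀ {p} → Saturated p → Lμ L μ p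
  saturated⇒∈Lμ {p} sat =
    valuesAbove p ,
    (λ { (lift (y , _ , k≈μy)) → y , k≈μy }) ,
    (λ { (lift (_ , p≤μy , k≈μy)) → ≤-respʳ-≈⁻ p≤μy k≈μy }) ,
    (λ lb → sat (λ y p≤μy → lb (lift (y , p≤μy , Eq.refl))))

  ∈Lμ⇒saturated : ∀ {p} → Lμ L μ p → Saturated p
  ∈Lμ⇒saturated (B , B⊆Image , p-lb , p-glb) {z} z-lb = p-glb λ b∈B →
    let (y , b≈μy) = B⊆Image b∈B
    in ≤-respʳ-≈⁻ (z-lb y (trans (p-lb b∈B) (reflexive b≈μy))) b≈μy

  value-saturated : ∀ y → Saturated (μ y)
  value-saturated y z-lb = z-lb y refl

  infimum-saturated : ∀ {s} {B : Pred Carrier s} {m} →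
                      (∀ {b} → B b → Saturated b) → IsInfimum poset B m → Saturated m
  infimum-saturated B-sat (m-lb , m-glb) z-lb =
    m-glb λ b∈B → B-sat b∈B λ y b≤μy → z-lb y (trans (m-lb b∈B) b≤μy)

  hull : Carrier → Carrier
  hull p = proj₁ (inf (valuesAbove p))

  hull-≤-value : ∀ {p} y → p ≤ μ y → hull p ≤ μ y
  hull-≤-value {p} y p≤μy = proj₁ (proj₂ (inf (valuesAbove p))) (lift (y , p≤μy , Eq.refl))

  hull-greatest : ∀ {p z} → (∀ y → p ≤ μ y → z ≤ μ y) → z ≤ hull p
  hull-greatest {p} z-lb = proj₂ (proj₂ (inf (valuesAbove p)))
    λ { (lift (y , p≤μy , k≈μy)) → ≤-respʳ-≈⁻ (z-lb y p≤μy) k≈μy }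

  ≤-hull : ∀ p → p ≤ hull p
  ≤-hull p = hull-greatest (λ _ p≤μy → p≤μy)

  hull-saturated : ∀ p → Saturated (hull p)
  hull-saturated p z-lb = hull-greatest (λ y p≤μy → z-lb y (hull-≤-value y p≤μy))

  hull-fixes-saturated : ∀ {p} → Saturated p → hull p ≈ p
  hull-fixes-saturated {p} sat = antisym (sat hull-≤-value) (≤-hull p)

  cut-hull : ∀ p → cut poset μ (hull p) ≐ cut poset μ p
  cut-hull p = (λ hull≤μy → trans (≤-hull p) hull≤μy) , hull-≤-value _

  hull-antitone : ∀ {p p'} → cut poset μ p' ⊆ cut poset μ p → hull p ≤ hull p'
  hull-antitone cut⊆ = hull-greatest (λ y p'≤μy → hull-≤-value y (cut⊆ p'≤μy))

  hull-reflects : ∀ {p p'} → hull p ≤ hull p' → cut poset μ p' ⊆ cut poset μ p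
  hull-reflects {p} {p'} hull≤hull p'≤μy =
    proj₁ (cut-hull p) (trans hull≤hull (hull-≤-value _ p'≤μy))

  hullLμ : Carrier → LμCarrier L μ
  hullLμ p = hull p , saturated⇒∈Lμ (hull-saturated p)

  cutToLμ : μLCarrier L μ → LμCarrier L μ
  cutToLμ (_ , p , _) = hullLμ p

  private
    Cut : Carrier → μLCarrier L μ
    Cut p = cut poset μ p , p , (λ h → h) , (λ h → h)

    cutToLμ-mono : ∀ {S T} → _⊇c_ L μ S T → hull (proj₁ (proj₂ S)) ≤ hull (proj₁ (proj₂ T))
    cutToLμ-mono {_ , _ , S≐cut} {_ , _ , T≐cut} S⊇T =
      hull-antitone (λ p'≤μy → proj₁ S≐cut (S⊇T (proj₂ T≐cut p'≤μy)))

    cutToLμ-cancel : ∀ {S T} → hull (proj₁ (proj₂ S)) ≤ hull (proj₁ (proj₂ T)) → _⊇c_ L μ S T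
    cutToLμ-cancel {_ , _ , S≐cut} {_ , _ , T≐cut} hull≤hull y∈T =
      proj₂ S≐cut (hull-reflects hull≤hull (proj₁ T≐cut y∈T))

    cutToLμ-cong : ∀ {S T} → _≐c_ L μ S T → hull (proj₁ (proj₂ S)) ≈ hull (proj₁ (proj₂ T))
    cutToLμ-cong {S} {T} (S⊆T , T⊆S) = antisym (cutToLμ-mono {S} {T} T⊆S) (cutToLμ-mono {T} {S} S⊆T)

  cutToLμ-isOrderIsomorphism :
    IsOrderIsomorphism (_≐c_ L μ) (Poset._≈_ (LμPoset L μ))
                       (_⊇c_ L μ) (Poset._≤_ (LμPoset L μ)) cutToLμ
  cutToLμ-isOrderIsomorphism = record
    { isOrderMonomorphism = record
      { isOrderHomomorphism = record
        { cong = λ {S} {T} → cutToLμ-cong {S} {T}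
        ; mono = λ {S} {T} → cutToLμ-mono {S} {T}
        }
      ; injective = λ {S} {T} hullS≈hullT →
          cutToLμ-cancel {T} {S} (reflexive (Eq.sym hullS≈hullT)) ,
          cutToLμ-cancel {S} {T} (reflexive hullS≈hullT)
      ; cancel = λ {S} {T} → cutToLμ-cancel {S} {T}
      }
    ; surjective = λ { (q , q∈Lμ) → Cut q , λ {S} S≐cut →
        Eq.trans (cutToLμ-cong {S} {Cut q} S≐cut)
                 (hull-fixes-saturated (∈Lμ⇒saturated q∈Lμ)) }
    }

  ι-preserves-infimum : ∀ {s} (S : Pred (LμCarrier L μ) s) →
                        ∃ λ q → IsInfimum (LμPoset L μ) S q
                              × IsInfimum poset (ι[_] L μ S) (ι L μ q)
  ι-preserves-infimum S =
    (m , saturated⇒∈Lμ m-saturated) ,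
    ((λ q∈S → m-lb (_ , q∈S , Eq.refl)) ,
     (λ q-lb → m-glb λ { (_ , r∈S , l≈r) → ≤-respʳ-≈⁻ (q-lb r∈S) l≈r })) ,
    m-infimum
    where
    m = proj₁ (inf (ι[_] L μ S))
    m-infimum = proj₂ (inf (ι[_] L μ S))
    m-lb = proj₁ m-infimum
    m-glb = proj₂ m-infimum

    m-saturated : Saturated m
    m-saturated = infimum-saturated
      (λ { (r , _ , l≈r) z-lb →
           ≤-respʳ-≈⁻ (∈Lμ⇒saturated (proj₂ r) λ y r≤μy →
                         z-lb y (trans (reflexive l≈r) r≤μy)) l≈r })
      m-infimum

  ι-preserves-top : ∃ λ t → IsTop (LμPoset L μ) t × IsTop poset (ι L μ t)
  ι-preserves-top = (⊤ , saturated⇒∈Lμ (λ _ → ⊤-top _)) , (λ q → ⊤-top (proj₁ q)) , ⊤-top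
    where
    ⊤ = proj₁ (inf {Level.zero} ∅)

    ⊤-top : ∀ q → q ≤ ⊤
    ⊤-top q = proj₂ (proj₂ (inf {Level.zero} ∅)) (λ ())

  ν : X → LμCarrier L μ
  ν y = μ y , saturated⇒∈Lμ (value-saturated y)

  Cuts-ν≐Cuts-μ : Cuts (LμPoset L μ) ν ≐ Cuts poset μ
  Cuts-ν≐Cuts-μ =
    (λ { ((p , _) , S≐cut) → p , S≐cut }) ,
    (λ { (p , (S⊆cut , cut⊆S)) →
           hullLμ p ,
           (λ y∈S → proj₂ (cut-hull p) (S⊆cut y∈S)) ,
           (λ hull≤μy → cut⊆S (proj₁ (cut-hull p) hull≤μy)) })

  Lμ-ν : ∀ q → Kν (LμPoset L μ) ν q
  Lμ-ν (q , q∈Lμ) =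
    νValuesAbove ,
    (λ { (lift (y , _ , k≈μy)) → y , k≈μy }) ,
    (λ { (lift (_ , q≤μy , k≈μy)) → ≤-respʳ-≈⁻ q≤μy k≈μy }) ,
    (λ lb → ∈Lμ⇒saturated q∈Lμ λ y q≤μy → lb {ν y} (lift (y , q≤μy , Eq.refl)))
    where
    νValuesAbove : Pred (LμCarrier L μ) _
    νValuesAbove k = Lift (Level.suc ℓ) (∃ λ y → q ≤ μ y × proj₁ k ≈ μ y)

theorem4 : ∀ {x c ℓ₁ ℓ₂ s : Level} (L : CompleteLattice c ℓ₁ ℓ₂) {X : Set x}
           → X → (μ : X → CompleteLattice.Carrier L)
           → (∃ λ (f : μLCarrier L μ → LμCarrier L μ)
                → IsOrderIsomorphism (_≐c_ L μ) (Poset._≈_ (LμPoset L μ))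
                                     (_⊇c_ L μ) (Poset._≤_ (LμPoset L μ)) f)
           × ((∀ (S : Pred (LμCarrier L μ) s)
                → ∃ λ q → IsInfimum (LμPoset L μ) S q
                        × IsInfimum (CompleteLattice.poset L) (ι[_] L μ S) (ι L μ q))
             × (∃ λ t → IsTop (LμPoset L μ) t
                      × IsTop (CompleteLattice.poset L) (ι L μ t)))
           × (∃ λ (ν : X → LμCarrier L μ)
                → (∀ y → μ y ≡ ι L μ (ν y))
                × (Cuts (LμPoset L μ) ν ≐ Cuts (CompleteLattice.poset L) μ)
                × (∀ q → Kν (LμPoset L μ) ν q))
theorem4 L _ μ =
  (cutToLμ , cutToLμ-isOrderIsomorphism) ,
  (ι-preserves-infimum , ι-preserves-top) ,
  (ν , (λ _ → ≡.refl) , Cuts-ν≐Cuts-μ , Lμ-ν)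
  where open FuzzySet L μ
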